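{- Let $w$ be a partial word which contains more than one square (as factors) but in which only one position starts a square. Then $H(w) = \{1\}$, i.e. the only hole of $w$ is at its first position.
   Context: Let $\Sigma$ be a finite alphabet and $\diamond \notin \Sigma$ a hole symbol. A partial word is a finite sequence over $\Sigma \cup \{\diamond\}$; a full word is a partial word with no holes. Positions are indexed from $1$; $w[i]$ is the symbol at position $i$ and $w[i..j]$ is the factor occupying positions $i$ to $j$, said to start at position $i$. $H(w) = \{ i : 1 \le i \le |w|,\ w[i] = \diamond\}$. For partial words $u, v$ of equal length, $u \subset v$ means that every non-hole position of $u$ is a non-hole position of $v$ carrying the same letter. A partial word $u$ is an $r$th power if $u \subset x^r$ for some nonempty full word $x$; $2$nd powers are called squares. -}

module Defs where

open import Data.Nat using (ℕ; zero; suc; _+_; _∸_; _≤_)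
open import Data.Fin using (Fin)
open import Data.Maybe using (Maybe; just; nothing)
open import Data.List using (List; []; _∷_; length; map; concat; replicate; take; drop)
open import Data.List.Relation.Binary.Pointwise using (Pointwise)
open import Data.Product using (Σ; _×_; ∃)
open import Data.Empty using (⊥)
open import Data.Unit using (⊤)
open import Relation.Binary.PropositionalEquality using (_≡_)
open import Relation.Nullary using (¬_)

-- The finite alphabet Σ is Fin k; the hole symbol ◇ is 'nothing'.
Symbol : ℕ → Set
Symbol k = Maybe (Fin k)

PWord : ℕ → Set
PWord k = List (Symbol k)

FWord : ℕ → Set
FWord k = List (Fin k)

full : ∀ {k} → FWord k → PWord k
full = map just

_⊑_ : ∀ {k} → Symbol k → Symbol k → Set
nothing ⊑ _       = ⊤
just a  ⊑ nothing = ⊥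
just a  ⊑ just b  = a ≡ b

_⊂_ : ∀ {k} → PWord k → PWord k → Set
u ⊂ v = Pointwise _⊑_ u v

_^_ : ∀ {k} → FWord k → ℕ → FWord k
x ^ r = concat (replicate r x)

IsPower : ∀ {k} → ℕ → PWord k → Set
IsPower {k} r u = Σ (FWord k) λ x → ¬ (x ≡ []) × (u ⊂ full (x ^ r))

IsSquare : ∀ {k} → PWord k → Set
IsSquare = IsPower 2

-- 1-indexed access: pos w i = just (w[i]) if 1 ≤ i ≤ |w|, else nothing.
pos : ∀ {A : Set} → List A → ℕ → Maybe A
pos []       _             = nothing
pos (x ∷ xs) zero          = nothing
pos (x ∷ xs) (suc zero)    = just x
pos (x ∷ xs) (suc (suc n)) = pos xs (suc n)

-- The factor of w starting at (1-indexed) position i of length l,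
-- i.e. w[i..i+l-1].
factor : ∀ {A : Set} → List A → ℕ → ℕ → List A
factor w i l = take l (drop (i ∸ 1) w)

ValidOcc : ∀ {A : Set} → List A → ℕ → ℕ → Set
ValidOcc w i l = (1 ≤ i) × (1 ≤ l) × (i + l ≤ suc (length w))

SquareOcc : ∀ {k} → PWord k → ℕ → ℕ → Set
SquareOcc w i l = ValidOcc w i l × IsSquare (factor w i l)

StartsSquare : ∀ {k} → PWord k → ℕ → Set
StartsSquare w i = ∃ λ l → SquareOcc w i l

MoreThanOneSquare : ∀ {k} → PWord k → Set
MoreThanOneSquare w =
  Σ ℕ λ i → Σ ℕ λ l → Σ ℕ λ j → Σ ℕ λ l′ →
    SquareOcc w i l × SquareOcc w j l′ × ¬ (factor w i l ≡ factor w j l′)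

AtMostOneSquareStart : ∀ {k} → PWord k → Set
AtMostOneSquareStart w = ∀ i j → StartsSquare w i → StartsSquare w j → i ≡ j

InH : ∀ {k} → PWord k → ℕ → Set
InH w i = (1 ≤ i) × (i ≤ length w) × (pos w i ≡ just nothing)

module Submission where

-- Squares are handled positionwise: w[i..i+2h) is a square exactly when
-- 1 ≤ h, the factor fits in w, and the symbols at i+t and i+h+t are
-- compatible for every t < h (SquareAt; the two directions are
-- squareOcc⇒SquareAt and SquareAt⇒SquareOcc).  By uniqueness of the start,
-- both given squares begin at the same position i and have half-lengths
-- m < m′.  Then:
--  * any length-2 factor containing a hole is a square, so a hole at a
--    position q ≥ 1 would give squares starting at q - 1 and at q (or, if q
--    is the last position, contradict the room needed by the square of
--    half-length m′ ≥ 2): holes only occur at position 0;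
--  * if position 0 were a letter, w would be hole-free; in a full word two
--    squares with the same start and different lengths are periodic enough
--    to produce a square starting strictly after i, which is impossible.

open import Defs
open import Data.Nat using (ℕ; zero; suc; _+_; _≤_; _<_; z≤n; s≤s; s≤s⁻¹; _≤?_; _<?_)
open import Data.Nat.Properties
open import Data.Nat.Tactic.RingSolver using (solve-∀)
open import Data.Fin using (Fin)
open import Data.Maybe using (just; nothing)
open import Data.Maybe.Properties using (just-injective)
open import Data.List using ([]; _∷_; length; _++_; take; drop; applyUpTo)
open import Data.List.Properties using (length-map; length-++; length-applyUpTo; map-++; ++-identityʳ)
open import Data.List.Relation.Binary.Pointwise using ([]; _∷_; Pointwise-length)
open import Data.Product using (Σ; _×_; _,_; proj₁; proj₂; ∃)
open import Data.Sum using (_⊎_; inj₁; inj₂)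
open import Data.Empty using (⊥; ⊥-elim)
open import Data.Unit using (⊤; tt)
open import Function.Bundles using (_⇔_; mk⇔)
open import Relation.Binary.PropositionalEquality
open import Relation.Binary.Definitions using (tri<; tri≈; tri>)
open import Relation.Nullary using (¬_; yes; no)

module _ {k : ℕ} where

  -- Lookup at a 0-indexed position; positions outside w read as holes.
  _!_ : PWord k → ℕ → Symbol k
  []      ! t     = nothing
  (s ∷ w) ! zero  = s
  (s ∷ w) ! suc t = w ! t

  infixl 30 _!_

  pos-! : ∀ (w : PWord k) t → t < length w → pos w (suc t) ≡ just (w ! t)
  pos-! (s ∷ w) zero    _          = refl
  pos-! (s ∷ w) (suc t) (s≤s t<n) = pos-! w t t<n

  !-drop : ∀ (w : PWord k) i t → drop i w ! t ≡ w ! (i + t)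
  !-drop w       zero    t = refl
  !-drop []      (suc i) t = refl
  !-drop (s ∷ w) (suc i) t = !-drop w i t

  !-take : ∀ (w : PWord k) l t → t < l → take l w ! t ≡ w ! t
  !-take []      (suc l) t       _          = refl
  !-take (s ∷ w) (suc l) zero    _          = refl
  !-take (s ∷ w) (suc l) (suc t) (s≤s t<l) = !-take w l t t<l

  !-factor : ∀ (w : PWord k) i l t → t < l → factor w (suc i) l ! t ≡ w ! (i + t)
  !-factor w i l t t<l = trans (!-take (drop i w) l t t<l) (!-drop w i t)

  length-factor : ∀ (w : PWord k) i l → i + l ≤ length w → length (factor w (suc i) l) ≡ l
  length-factor w       zero    zero    _          = refl
  length-factor (s ∷ w) zero    (suc l) (s≤s fits) = cong suc (length-factor w zero l fits)
  length-factor (s ∷ w) (suc i) l       (s≤s fits) = length-factor w i l fits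

  !-++ˡ : ∀ (u v : PWord k) t → t < length u → (u ++ v) ! t ≡ u ! t
  !-++ˡ (s ∷ u) v zero    _          = refl
  !-++ˡ (s ∷ u) v (suc t) (s≤s t<n) = !-++ˡ u v t t<n

  !-++ʳ : ∀ (u v : PWord k) t → (u ++ v) ! (length u + t) ≡ v ! t
  !-++ʳ []      v t = refl
  !-++ʳ (s ∷ u) v t = !-++ʳ u v t

  ⊂⇒! : ∀ {u v : PWord k} → u ⊂ v → ∀ t → u ! t ⊑ v ! t
  ⊂⇒! []           t       = tt
  ⊂⇒! (s⊑r ∷ u⊂v) zero    = s⊑r
  ⊂⇒! (_   ∷ u⊂v) (suc t) = ⊂⇒! u⊂v t

  !⇒⊂ : ∀ (u v : PWord k) → length u ≡ length v →
        (∀ t → t < length u → u ! t ⊑ v ! t) → u ⊂ v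
  !⇒⊂ []      []      _  _ = []
  !⇒⊂ (s ∷ u) (r ∷ v) eq f =
    f 0 (s≤s z≤n) ∷ !⇒⊂ u v (suc-injective eq) (λ t t<n → f (suc t) (s≤s t<n))

  full-square : ∀ (x : FWord k) → full (x ^ 2) ≡ full x ++ full x
  full-square x = trans (map-++ just x (x ++ [])) (cong (λ y → full x ++ full y) (++-identityʳ x))

  length-full-square : ∀ (x : FWord k) → length (full (x ^ 2)) ≡ length x + length x
  length-full-square x = begin
    length (full (x ^ 2))             ≡⟨ cong length (full-square x) ⟩
    length (full x ++ full x)         ≡⟨ length-++ (full x) ⟩
    length (full x) + length (full x) ≡⟨ cong₂ _+_ (length-map just x) (length-map just x) ⟩
    length x + length x               ∎
    where open ≡-Reasoning

  square-lookupˡ : ∀ (x : FWord k) t → t < length x → full (x ^ 2) ! t ≡ full x ! t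
  square-lookupˡ x t t<h = trans (cong (_! t) (full-square x))
                                 (!-++ˡ (full x) (full x) t (subst (t <_) (sym (length-map just x)) t<h))

  square-lookupʳ : ∀ (x : FWord k) t → full (x ^ 2) ! (length x + t) ≡ full x ! t
  square-lookupʳ x t = begin
    full (x ^ 2) ! (length x + t)               ≡⟨ cong (_! (length x + t)) (full-square x) ⟩
    (full x ++ full x) ! (length x + t)         ≡⟨ cong (λ n → (full x ++ full x) ! (n + t)) (sym (length-map just x)) ⟩
    (full x ++ full x) ! (length (full x) + t)  ≡⟨ !-++ʳ (full x) (full x) t ⟩
    full x ! t                                  ∎
    where open ≡-Reasoning

  !-full-applyUpTo : ∀ (f : ℕ → Fin k) n t → t < n → full (applyUpTo f n) ! t ≡ just (f t)
  !-full-applyUpTo f (suc n) zero    _          = refl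
  !-full-applyUpTo f (suc n) (suc t) (s≤s t<n) = !-full-applyUpTo (λ t → f (suc t)) n t t<n

  _↑_ : Symbol k → Symbol k → Set
  just a ↑ just b = a ≡ b
  _      ↑ _      = ⊤

  ↑-refl : ∀ s → s ↑ s
  ↑-refl nothing  = tt
  ↑-refl (just a) = refl

  ↑-hole : ∀ s → s ↑ nothing
  ↑-hole nothing  = tt
  ↑-hole (just a) = tt

  ⊑-common⇒↑ : ∀ s r c → s ⊑ c → r ⊑ c → s ↑ r
  ⊑-common⇒↑ nothing  r        c        _   _   = tt
  ⊑-common⇒↑ (just a) nothing  c        _   _   = tt
  ⊑-common⇒↑ (just a) (just b) (just c) a≡c b≡c = trans a≡c (sym b≡c)

  join : Fin k → Symbol k → Symbol k → Fin k
  join a (just b) _        = b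
  join a nothing  (just c) = c
  join a nothing  nothing  = a

  join-upper : ∀ a s r → s ↑ r → (s ⊑ just (join a s r)) × (r ⊑ just (join a s r))
  join-upper a nothing  nothing  _   = tt , tt
  join-upper a nothing  (just c) _   = tt , refl
  join-upper a (just b) nothing  _   = refl , tt
  join-upper a (just b) (just c) b≡c = refl , sym b≡c

  record SquareAt (w : PWord k) (i h : ℕ) : Set where
    field
      nonempty          : 1 ≤ h
      fits              : i + (h + h) ≤ length w
      halves-compatible : ∀ t → t < h → w ! (i + t) ↑ w ! (i + (h + t))

  squareOcc⇒SquareAt : ∀ (w : PWord k) i l → SquareOcc w i l →
    Σ ℕ λ i₀ → Σ ℕ λ h → i ≡ suc i₀ × l ≡ h + h × SquareAt w i₀ h
  squareOcc⇒SquareAt w (suc i₀) l (_ , [] , x≢[] , _) = ⊥-elim (x≢[] refl)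
  squareOcc⇒SquareAt w (suc i₀) l ((_ , _ , s≤s fits) , x@(_ ∷ _) , _ , u⊂xx) =
      i₀ , h , refl , l≡h+h , record
        { nonempty          = s≤s z≤n
        ; fits              = subst (λ n → i₀ + n ≤ length w) l≡h+h fits
        ; halves-compatible = λ t t<h → ⊑-common⇒↑ _ _ (full x ! t)
            (subst₂ _⊑_ (!-factor w i₀ l t (≤-trans t<h h≤l)) (square-lookupˡ x t t<h) (⊂⇒! u⊂xx t))
            (subst₂ _⊑_ (!-factor w i₀ l (h + t) (subst (h + t <_) (sym l≡h+h) (+-monoʳ-< h t<h)))
                        (square-lookupʳ x t) (⊂⇒! u⊂xx (h + t)))
        }
    where
      h = length x
      l≡h+h : l ≡ h + h
      l≡h+h = trans (sym (length-factor w i₀ l fits))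
                    (trans (Pointwise-length u⊂xx) (length-full-square x))
      h≤l : h ≤ l
      h≤l = subst (h ≤_) (sym l≡h+h) (m≤m+n h h)

  squareOcc⇒letter : ∀ {w : PWord k} {i l} → SquareOcc w i l → Fin k
  squareOcc⇒letter (_ , []    , x≢[] , _) = ⊥-elim (x≢[] refl)
  squareOcc⇒letter (_ , a ∷ _ , _    , _) = a

  halves : ∀ h t → t < h + h → t < h ⊎ Σ ℕ λ t′ → t′ < h × t ≡ h + t′
  halves h t t<2h with t <? h
  ... | yes t<h = inj₁ t<h
  ... | no  t≮h with m≤n⇒∃[o]m+o≡n (≮⇒≥ t≮h)
  ...   | t′ , refl = inj₂ (t′ , +-cancelˡ-< h t′ h t<2h , refl)

  -- Conversely, over a nonempty alphabet, SquareAt yields a square occurrence: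
  -- the root is obtained by joining the two halves position by position.
  SquareAt⇒SquareOcc : Fin k → ∀ {w : PWord k} {i h} → SquareAt w i h → SquareOcc w (suc i) (h + h)
  SquareAt⇒SquareOcc a {w} {i} {h} sq =
      (s≤s z≤n , ≤-trans nonempty (m≤m+n h h) , s≤s fits) , x , x≢[] nonempty , u⊂xx
    where
      open SquareAt sq
      f : ℕ → Fin k
      f t = join a (w ! (i + t)) (w ! (i + (h + t)))
      x = applyUpTo f h
      x≢[] : 1 ≤ h → ¬ x ≡ []
      x≢[] (s≤s _) ()
      |x|≡h : length x ≡ h
      |x|≡h = length-applyUpTo f h
      contained : ∀ t → t < h + h → factor w (suc i) (h + h) ! t ⊑ full (x ^ 2) ! t
      contained t t<2h with halves h t t<2h
      ... | inj₁ t<h = subst₂ _⊑_ (sym (!-factor w i (h + h) t t<2h))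
          (sym (trans (square-lookupˡ x t (subst (t <_) (sym |x|≡h) t<h)) (!-full-applyUpTo f h t t<h)))
          (proj₁ (join-upper a _ _ (halves-compatible t t<h)))
      ... | inj₂ (t′ , t′<h , refl) = subst₂ _⊑_ (sym (!-factor w i (h + h) (h + t′) t<2h))
          (sym (trans (subst (λ n → full (x ^ 2) ! (n + t′) ≡ full x ! t′) |x|≡h (square-lookupʳ x t′))
                      (!-full-applyUpTo f h t′ t′<h)))
          (proj₂ (join-upper a _ _ (halves-compatible t′ t′<h)))
      u⊂xx : factor w (suc i) (h + h) ⊂ full (x ^ 2)
      u⊂xx = !⇒⊂ _ _
        (trans (length-factor w i (h + h) fits) (sym (trans (length-full-square x) (cong₂ _+_ |x|≡h |x|≡h))))
        (λ t t<n → contained t (subst (t <_) (length-factor w i (h + h) fits) t<n))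

  hole-square : ∀ {w : PWord k} {q} → q + 2 ≤ length w →
                w ! q ≡ nothing ⊎ w ! suc q ≡ nothing → SquareAt w q 1
  hole-square {w} {q} fits hole = record
    { nonempty          = s≤s z≤n
    ; fits              = fits
    ; halves-compatible = λ { zero _ → subst₂ _↑_ (cong (w !_) (sym (+-identityʳ q)))
                                                  (cong (w !_) (sym (+-comm q 1))) (compatible hole)
                            ; (suc t) (s≤s ()) }
    }
    where
      compatible : w ! q ≡ nothing ⊎ w ! suc q ≡ nothing → w ! q ↑ w ! suc q
      compatible (inj₁ e) = subst (_↑ w ! suc q) (sym e) tt
      compatible (inj₂ e) = subst (w ! q ↑_) (sym e) (↑-hole (w ! q))

  Hole : PWord k → ℕ → Set
  Hole w q = q < length w × w ! q ≡ nothing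

  HoleFree : PWord k → Set
  HoleFree w = ∀ t → t < length w → ∃ λ a → w ! t ≡ just a

  square-period : ∀ {w : PWord k} {i h} → HoleFree w → SquareAt w i h →
                  ∀ t → t < h → w ! (i + t) ≡ w ! (i + (h + t))
  square-period {w} {i} {h} holeFree sq t t<h
    with holeFree (i + t) (<-≤-trans (+-monoʳ-< i (≤-trans t<h (m≤m+n h h))) (SquareAt.fits sq))
       | holeFree (i + (h + t)) (<-≤-trans (+-monoʳ-< i (+-monoʳ-< h t<h)) (SquareAt.fits sq))
  ... | a , e₁ | b , e₂ =
    trans e₁ (trans (cong just (subst₂ _↑_ e₁ e₂ (SquareAt.halves-compatible sq t t<h))) (sym e₂))

  period⇒SquareAt : ∀ {w : PWord k} {j h} → 1 ≤ h → j + (h + h) ≤ length w →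
                    (∀ t → t < h → w ! (j + t) ≡ w ! (j + (h + t))) → SquareAt w j h
  period⇒SquareAt {w} {j} 1≤h fits period = record
    { nonempty          = 1≤h
    ; fits              = fits
    ; halves-compatible = λ t t<h → subst (w ! (j + t) ↑_) (period t t<h) (↑-refl _)
    }

  shifted-square-long : ∀ {w : PWord k} {i m m′} → HoleFree w →
    SquareAt w i m → SquareAt w i m′ → m + m ≤ m′ → SquareAt w (i + m′) m
  shifted-square-long {w} {i} {m} {m′} holeFree sq sq′ 2m≤m′ =
      period⇒SquareAt (SquareAt.nonempty sq) fits shifted
    where
      m<m′ : m < m′
      m<m′ = <-≤-trans (m<m+n m (SquareAt.nonempty sq)) 2m≤m′
      fits : i + m′ + (m + m) ≤ length w
      fits = ≤-trans (+-monoʳ-≤ (i + m′) 2m≤m′)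
                     (subst (_≤ length w) (sym (+-assoc i m′ m′)) (SquareAt.fits sq′))
      shifted : ∀ t → t < m → w ! (i + m′ + t) ≡ w ! (i + m′ + (m + t))
      shifted t t<m = begin
        w ! (i + m′ + t)            ≡⟨ cong (w !_) (+-assoc i m′ t) ⟩
        w ! (i + (m′ + t))          ≡⟨ square-period holeFree sq′ t (<-trans t<m m<m′) ⟨
        w ! (i + t)                 ≡⟨ square-period holeFree sq t t<m ⟩
        w ! (i + (m + t))           ≡⟨ square-period holeFree sq′ (m + t) (<-≤-trans (+-monoʳ-< m t<m) 2m≤m′) ⟩
        w ! (i + (m′ + (m + t)))    ≡⟨ cong (w !_) (+-assoc i m′ (m + t)) ⟨
        w ! (i + m′ + (m + t))      ∎
        where open ≡-Reasoning

  shifted-square-short : ∀ {w : PWord k} {i m d} → HoleFree w →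
    SquareAt w i m → SquareAt w i (m + d) → 1 ≤ d → d < m → SquareAt w (i + m) d
  shifted-square-short {w} {i} {m} {d} holeFree sq sq′ 1≤d d<m =
      period⇒SquareAt 1≤d fits shifted
    where
      layout : ∀ i m d → i + ((m + d) + (m + d)) ≡ (i + m + (d + d)) + m
      layout = solve-∀
      fits : i + m + (d + d) ≤ length w
      fits = ≤-trans (m≤m+n _ m) (subst (_≤ length w) (layout i m d) (SquareAt.fits sq′))
      shifted : ∀ t → t < d → w ! (i + m + t) ≡ w ! (i + m + (d + t))
      shifted t t<d = begin
        w ! (i + m + t)              ≡⟨ cong (w !_) (+-assoc i m t) ⟩
        w ! (i + (m + t))            ≡⟨ square-period holeFree sq t (<-trans t<d d<m) ⟨
        w ! (i + t)                  ≡⟨ square-period holeFree sq′ t (<-≤-trans (<-trans t<d d<m) (m≤m+n m d)) ⟩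
        w ! (i + ((m + d) + t))      ≡⟨ cong (λ n → w ! (i + n)) (+-assoc m d t) ⟩
        w ! (i + (m + (d + t)))      ≡⟨ cong (w !_) (+-assoc i m (d + t)) ⟨
        w ! (i + m + (d + t))        ∎
        where open ≡-Reasoning

  later-square : ∀ {w : PWord k} {i m m′} → HoleFree w →
    SquareAt w i m → SquareAt w i m′ → m < m′ → Σ ℕ λ j → Σ ℕ λ h → i < j × SquareAt w j h
  later-square {w} {i} {m} {m′} holeFree sq sq′ m<m′ with m + m ≤? m′
  ... | yes 2m≤m′ = i + m′ , m , m<m+n i (<-≤-trans (s≤s z≤n) (SquareAt.nonempty sq′))
                  , shifted-square-long holeFree sq sq′ 2m≤m′
  ... | no  2m≰m′ with m≤n⇒∃[o]m+o≡n (<⇒≤ m<m′)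
  ...   | zero  , m+0≡m′ = ⊥-elim (<-irrefl (trans (sym (+-identityʳ m)) m+0≡m′) m<m′)
  ...   | suc d , refl   = i + m , suc d , m<m+n i (SquareAt.nonempty sq)
                         , shifted-square-short holeFree sq sq′ (s≤s z≤n) (+-cancelˡ-< m (suc d) m (≰⇒> 2m≰m′))

  OnlyStart : PWord k → ℕ → Set
  OnlyStart w i = ∀ {j h} → SquareAt w j h → j ≡ i

  -- If all squares start at i and one of them has half-length ≥ 2, then
  -- holes occur only at position 0: a hole at q + 1 makes the factors at q
  -- and (if it fits) at q + 1 squares, and otherwise leaves no room.
  holes-at-start : ∀ {w : PWord k} {i h} → OnlyStart w i → SquareAt w i h → 2 ≤ h →
                   ∀ q → Hole w q → q ≡ 0
  holes-at-start only sq 2≤h zero _ = refl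
  holes-at-start {w} {i} {h} only sq 2≤h (suc q) (q<n , hole) = ⊥-elim (no-room (only left))
    where
      left : SquareAt w q 1
      left = hole-square (subst (_≤ length w) (+-comm 2 q) q<n) (inj₂ hole)
      4≰2 : ¬ 4 ≤ 2
      4≰2 (s≤s (s≤s ()))
      no-room : q ≡ i → ⊥
      no-room q≡i with suc q + 2 ≤? length w
      ... | yes fits = 1+n≢n (trans (only (hole-square fits (inj₁ hole))) (sym q≡i))
      ... | no ¬fits = 4≰2 (≤-trans (+-mono-≤ 2≤h 2≤h) (+-cancelˡ-≤ q (h + h) 2
                          (≤-trans (subst (λ n → n + (h + h) ≤ length w) (sym q≡i) (SquareAt.fits sq))
                                   (s≤s⁻¹ (≰⇒> ¬fits)))))

  -- With a unique square start carrying squares of two lengths and holes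
  -- only at position 0, position 0 is a hole: otherwise w is hole-free and
  -- later-square produces a square starting elsewhere.
  first-is-hole : ∀ {w : PWord k} {i m m′} → OnlyStart w i → SquareAt w i m → SquareAt w i m′ →
                  m < m′ → (∀ q → Hole w q → q ≡ 0) → Hole w 0
  first-is-hole {w} {i} {m} only sq sq′ m<m′ holes = 0<|w| , first-symbol
    where
      0<|w| : 0 < length w
      0<|w| = ≤-trans (SquareAt.nonempty sq)
                (≤-trans (m≤m+n m m) (≤-trans (m≤n+m (m + m) i) (SquareAt.fits sq)))
      hole-free : ∀ {a} → w ! 0 ≡ just a → HoleFree w
      hole-free e t t<n with w ! t in e′
      ... | just b  = b , refl
      ... | nothing with holes t (t<n , e′)
      ...   | refl with trans (sym e) e′
      ...     | ()
      first-symbol : w ! 0 ≡ nothing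
      first-symbol with w ! 0 in e
      ... | nothing = refl
      ... | just a with later-square (hole-free e) sq sq′ m<m′
      ...   | j , h , i<j , later = ⊥-elim (<-irrefl (sym (only later)) i<j)

  SharedStart : PWord k → Set
  SharedStart w =
    Σ ℕ λ i → Σ ℕ λ m → Σ ℕ λ m′ → m < m′ × SquareAt w i m × SquareAt w i m′ × OnlyStart w i

  shared-start : ∀ {w : PWord k} → MoreThanOneSquare w → AtMostOneSquareStart w → SharedStart w
  shared-start {w} (i , l , j , l′ , occ , occ′ , distinct) unique
    with squareOcc⇒SquareAt w i l occ | squareOcc⇒SquareAt w j l′ occ′
  ... | i₀ , h , refl , refl , sq | j₀ , h′ , refl , refl , sq′ = ordered (only sq′) sq′
    where
      only : OnlyStart w i₀
      only sq″ = suc-injective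
        (unique _ _ (_ , SquareAt⇒SquareOcc (squareOcc⇒letter occ) sq″) (h + h , occ))
      ordered : j₀ ≡ i₀ → SquareAt w j₀ h′ → SharedStart w
      ordered refl sq₂ with <-cmp h h′
      ... | tri< h<h′ _ _ = i₀ , h , h′ , h<h′ , sq , sq₂ , only
      ... | tri≈ _ refl _ = ⊥-elim (distinct refl)
      ... | tri> _ _ h′<h = i₀ , h′ , h , h′<h , sq₂ , sq , only

lemma3 : (k : ℕ) (w : PWord k) → MoreThanOneSquare w → AtMostOneSquareStart w →
           ∀ i → InH w i ⇔ (i ≡ 1)
lemma3 k w many unique p with shared-start many unique
... | i , m , m′ , m<m′ , sq , sq′ , only = mk⇔ hole⇒first (λ { refl → first-in-H })
  where
    holes : ∀ q → Hole w q → q ≡ 0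
    holes = holes-at-start only sq′ (<-≤-trans (s≤s (SquareAt.nonempty sq)) m<m′)
    hole⇒first : ∀ {p} → InH w p → p ≡ 1
    hole⇒first {zero}  (() , _)
    hole⇒first {suc q} (_ , q<n , e) = cong suc (holes q (q<n , just-injective (trans (sym (pos-! w q q<n)) e)))
    first-in-H : InH w 1
    first-in-H with first-is-hole only sq sq′ m<m′ holes
    ... | 0<n , e = s≤s z≤n , 0<n , trans (pos-! w 0 0<n) (cong just e)
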